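{- Let $G=(V,E)$ be a graph on $n$ nodes, $\pi$ a permutation of $V$, $k\ge 1$ an integer, $r \ge 0$ an integer and $R=\{v\in V : \pi(v)\le r\}$. Let $A=\{u\in V : \mathrm{FindPivot}(u,\pi,R)\neq \mathtt{null}\}$ and $B=V\setminus A$. Then for every node $u\in V$: $u\in A$ if and only if $\mathrm{pivot}_\pi(u)\in A$, and $u \in B$ if and only if $\mathrm{pivot}_\pi(u)\in B$.
   Context: $G$ is a simple undirected graph (the graph of $+1$ edges); $N(u)$ is the neighbor set of $u$. A permutation $\pi:V\to[n]$ is a bijection; $u$ has higher rank than $v$ if $\pi(u)<\pi(v)$. Procedure $\mathrm{FindPivot}(u,\pi,R)$ (with parameter $k$): set a global counter $\gamma\gets 0$ and compute $p\gets \mathrm{Rec}(u)$; if $p=\mathtt{timeout}$ return $u$, otherwise return $p$. Procedure $\mathrm{Rec}(v)$: if $\gamma\ge k$ return $\mathtt{timeout}$; let $Q(v)=\{w\in (N(v)\cup\{v\})\cap R : \pi(w)\le \pi(v)\}$ sorted in increasing order of $\pi$; for each $w\in Q(v)$ in this order: if $w=v$ return $v$; otherwise set $\gamma\gets\gamma+1$, compute $p\gets \mathrm{Rec}(w)$, and if $p=\mathtt{timeout}$ or $p=w$ return $p$. If the loop finishes, return $\mathtt{null}$. The PrunedPivot pivot of $u$ is $\mathrm{pivot}_\pi(u) := \mathrm{FindPivot}(u,\pi,V)$ (i.e. the same procedure with $R=V$); the PrunedPivot clustering puts nodes with the same pivot into the same cluster. -}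

module Defs where

open import Data.Nat using (ℕ; zero; suc; _≤ᵇ_; _<ᵇ_; _∸_)
open import Data.Fin using (Fin; toℕ; _≟_)
open import Data.Bool using (Bool; true; false; _∧_; _∨_; if_then_else_)
open import Data.List using (List; []; _∷_; map; filterᵇ)
open import Data.List using () renaming (List to L)
open import Data.Vec.Functional using ()
open import Data.Fin.Base using ()
open import Data.List.Base using ()
open import Data.Maybe using (Maybe; just; nothing)
open import Data.Product using (_×_; _,_)
open import Relation.Binary.PropositionalEquality using (_≡_)
open import Relation.Nullary using (¬_; does)
open import Function.Bundles using (_↔_; Inverse)

record SimpleGraph (n : ℕ) : Set where
  field
    adj     : Fin n → Fin n → Bool
    sym     : ∀ u v → adj u v ≡ adj v u
    irrefl  : ∀ v → adj v v ≡ false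
open SimpleGraph public

-- A permutation π : V → [n].  Ranks are 0-based here: rank π(v) ∈ {0,…,n-1}
-- corresponds to the paper's rank π(v)+1 ∈ {1,…,n}.
Perm : ℕ → Set
Perm n = Fin n ↔ Fin n

rank : ∀ {n} → Perm n → Fin n → ℕ
rank π v = toℕ (Inverse.to π v)

byRank : ∀ {n} → Perm n → List (Fin n)
byRank {n} π = map (Inverse.from π) (Data.List.allFin n)

Q : ∀ {n} → SimpleGraph n → Perm n → (Fin n → Bool) → Fin n → List (Fin n)
Q G π R v = filterᵇ (λ w → (does (w ≟ v) ∨ adj G v w) ∧ R w ∧ (rank π w ≤ᵇ rank π v)) (byRank π)

data Res (n : ℕ) : Set where
  timeout : Res n
  null    : Res n
  node    : Fin n → Res n

-- Rec with the global counter threaded as the remaining budget b = k - γ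
-- (γ ≥ k  iff  b = 0).  The extra argument d is structural recursion fuel
-- bounding the nesting depth; since every nested call goes to a node of
-- strictly smaller rank, depth n is never exhausted when started with d = n.
mutual
  rec : ∀ {n} → SimpleGraph n → Perm n → (Fin n → Bool)
      → (d : ℕ) → (b : ℕ) → Fin n → Res n × ℕ
  rec G π R d zero v = timeout , zero
  rec G π R d (suc b) v = loop G π R d v (Q G π R v) (suc b)

  loop : ∀ {n} → SimpleGraph n → Perm n → (Fin n → Bool)
       → (d : ℕ) → Fin n → List (Fin n) → ℕ → Res n × ℕ
  loop G π R d v [] b = null , b
  loop G π R d v (w ∷ ws) b with does (w ≟ v)
  ... | true  = node v , b
  ... | false with d
  ...   | zero   = timeout , b                         -- unreachable when d = n
  ...   | suc d' with rec G π R d' (b ∸ 1) w           -- γ ← γ + 1 ; p ← Rec(w)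
  ...     | timeout , b' = timeout , b'
  ...     | null , b'    = loop G π R d v ws b'
  ...     | node p , b'  = if does (p ≟ w) then (node p , b') else loop G π R d v ws b'

findPivot : ∀ {n} → SimpleGraph n → Perm n → (k : ℕ) → (Fin n → Bool) → Fin n → Maybe (Fin n)
findPivot {n} G π k R u with rec G π R n k u
... | timeout , _ = just u
... | null , _    = nothing
... | node p , _  = just p

allV : ∀ {n} → Fin n → Bool
allV _ = true

pivot : ∀ {n} → SimpleGraph n → Perm n → ℕ → Fin n → Maybe (Fin n)
pivot G π k u = findPivot G π k allV u

-- R = { v : π(v) ≤ r }  (paper's 1-based rank π(v) = rank π v + 1)
prefixR : ∀ {n} → Perm n → ℕ → Fin n → Bool
prefixR π r v = rank π v <ᵇ r

InA : ∀ {n} → SimpleGraph n → Perm n → ℕ → ℕ → Fin n → Set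
InA G π k r u = ¬ (findPivot G π k (prefixR π r) u ≡ nothing)

InB : ∀ {n} → SimpleGraph n → Perm n → ℕ → ℕ → Fin n → Set
InB G π k r u = ¬ InA G π k r u

-- R = {v : π(v) ≤ r} is an initial segment of the ranking, so Q(v) computed inside R is a prefix
-- of Q(v) computed inside V and the rest of the latter lies outside R.  Hence Rec inside R makes
-- the same nested calls, with the same counter, as Rec inside V until its list runs out.  Either
-- both runs of Rec(u) give the same answer (a timeout, or a node p ∈ R; then u ∈ A and p ∈ A,
-- since Rec(p) inside R meets p itself), or the R-run returns null, so u ∈ B, while the V-run
-- continues outside R.  If the V-run then returns a node p ≠ u, this came from a nested call
-- Rec(p) with p ∉ R; the R-run of Rec(p) with the same depth and budget cannot agree with it, so
-- it returned null, and it still does with the full depth and budget of FindPivot: p ∈ B.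

module Submission where

open import Defs hiding (sym)
open import Data.Nat using (ℕ; zero; suc; _≤_; _<_; _+_; _∸_; _≤ᵇ_; z≤n; s≤s)
open import Data.Nat.Properties
  using (≤-refl; ≤-trans; <-trans; n≤1+n; m∸n≤m; m+[n∸m]≡n; <ᵇ⇒<; <⇒<ᵇ; ≤⇒≤ᵇ)
open import Data.Fin using (Fin; toℕ; _≟_)
open import Data.Bool using (Bool; true; false; _∧_; _∨_; T)
open import Data.Bool.Properties using (T-∧; ∧-zeroʳ)
open import Data.List using (List; []; _∷_; _++_; filterᵇ)
open import Data.List.Properties using (filter-≐; filter-none)
open import Data.List.Relation.Unary.All as All using (All; []; _∷_)
open import Data.List.Relation.Unary.All.Properties using (all-filter) renaming (filter⁺ to All-filter⁺)
open import Data.List.Relation.Unary.AllPairs using (AllPairs; []; _∷_) renaming (map to AllPairs-map)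
open import Data.List.Relation.Unary.AllPairs.Properties using (tabulate⁺-<) renaming (map⁺ to AllPairs-map⁺)
open import Data.List.Membership.Propositional using (_∈_)
open import Data.List.Membership.Propositional.Properties using (∈-allFin; ∈-map⁺; ∈-filter⁺)
open import Data.List.Relation.Unary.Any using (here; there)
open import Data.Maybe using (just; nothing)
open import Data.Product using (Σ; ∃-syntax; _×_; _,_; proj₁; proj₂)
open import Data.Sum using (_⊎_; inj₁; inj₂)
open import Data.Unit using (⊤; tt)
open import Data.Empty using (⊥-elim)
open import Function using (_∘_)
open import Function.Bundles using (_⇔_; mk⇔; Equivalence; Inverse)
open import Function.Properties.Equivalence using () renaming (refl to ⇔-refl; sym to ⇔-sym; trans to ⇔-trans)
open import Function.Related.TypeIsomorphisms using (¬-cong-⇔)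
open import Relation.Binary.PropositionalEquality using (_≡_; _≢_; refl; sym; trans; cong; subst; subst₂)
open import Relation.Nullary using (¬_; yes; no; does)
open import Relation.Nullary.Decidable using (T?)

filterᵇ-cong : ∀ {a} {A : Set a} {p q : A → Bool} → (∀ x → p x ≡ q x) →
               ∀ xs → filterᵇ p xs ≡ filterᵇ q xs
filterᵇ-cong {p = p} {q} p≗q =
  filter-≐ (T? ∘ p) (T? ∘ q) ((λ {x} → subst T (p≗q x)) , (λ {x} → subst T (sym (p≗q x))))

filterᵇ-prefix-split : ∀ {a} {A : Set a} (q p : A → Bool) {xs : List A} →
  AllPairs (λ x y → T (q y) → T (q x)) xs →
  ∃[ ys ] filterᵇ p xs ≡ filterᵇ (λ x → q x ∧ p x) xs ++ ys × All (λ y → ¬ T (q y)) ys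
filterᵇ-prefix-split q p [] = [] , refl , []
filterᵇ-prefix-split q p {x ∷ xs} (x↑ ∷ xs↑) with q x in qx
... | true with filterᵇ-prefix-split q p xs↑ | p x
...   | ys , split , ys∉q | true = ys , cong (x ∷_) split , ys∉q
...   | ys , split , ys∉q | false = ys , split , ys∉q
filterᵇ-prefix-split q p {x ∷ xs} (x↑ ∷ xs↑) | false =
  filterᵇ p (x ∷ xs) , cong (_++ filterᵇ p (x ∷ xs)) (sym none) , All-filter⁺ (T? ∘ p) (x∉q ∷ x↑)
  where
  x∉q : ¬ T (q x)
  x∉q = subst (¬_ ∘ T) (sym qx) (λ ())
  none : filterᵇ (λ y → q y ∧ p y) xs ≡ []
  none = filter-none (T? ∘ (λ y → q y ∧ p y)) (All.map (λ y∉q → y∉q ∘ proj₁ ∘ Equivalence.to T-∧) x↑)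

module _ {n : ℕ} (π : Perm n) where

  rank-from : ∀ i → rank π (Inverse.from π i) ≡ toℕ i
  rank-from i = cong toℕ (Inverse.strictlyInverseˡ π i)

  byRank-sorted : AllPairs (λ x y → rank π x < rank π y) (byRank π)
  byRank-sorted =
    AllPairs-map⁺ (tabulate⁺-< (λ {i} {j} → subst₂ _<_ (sym (rank-from i)) (sym (rank-from j))))

  ∈-byRank : ∀ v → v ∈ byRank π
  ∈-byRank v = subst (_∈ byRank π) (Inverse.strictlyInverseʳ π v)
                     (∈-map⁺ (Inverse.from π) (∈-allFin (Inverse.to π v)))

  prefixR-prefix : ∀ r → AllPairs (λ x y → T (prefixR π r y) → T (prefixR π r x)) (byRank π)
  prefixR-prefix r =
    AllPairs-map (λ {x} {y} x<y y∈R → <⇒<ᵇ (<-trans x<y (<ᵇ⇒< (rank π y) r y∈R))) byRank-sorted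

module Run {n : ℕ} (G : SimpleGraph n) (π : Perm n) (R : Fin n → Bool) where

  mutual
    rec-budget-≤ : ∀ d b v → proj₂ (rec G π R d b v) ≤ b
    rec-budget-≤ d zero    v = z≤n
    rec-budget-≤ d (suc b) v = loop-budget-≤ d v (Q G π R v) (suc b)

    loop-budget-≤ : ∀ d v xs b → proj₂ (loop G π R d v xs b) ≤ b
    loop-budget-≤ zero    v []       b = ≤-refl
    loop-budget-≤ zero    v (w ∷ ws) b with w ≟ v
    ... | yes _ = ≤-refl
    ... | no _  = ≤-refl
    loop-budget-≤ (suc d) v xs b = go xs b
      where
      go : ∀ xs b → proj₂ (loop G π R (suc d) v xs b) ≤ b
      go []       b = ≤-refl
      go (w ∷ ws) b with w ≟ v
      ... | yes _ = ≤-refl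
      ... | no _ with rec G π R d (b ∸ 1) w | rec-budget-≤ d (b ∸ 1) w
      ...   | timeout , _  | b′≤ = ≤-trans b′≤ (m∸n≤m b 1)
      ...   | null    , b′ | b′≤ = ≤-trans (go ws b′) (≤-trans b′≤ (m∸n≤m b 1))
      ...   | node p  , b′ | b′≤ with p ≟ w
      ...     | yes _ = ≤-trans b′≤ (m∸n≤m b 1)
      ...     | no _  = ≤-trans (go ws b′) (≤-trans b′≤ (m∸n≤m b 1))

  loop-≢-null : ∀ d v xs b → v ∈ xs → proj₁ (loop G π R d v xs b) ≢ null
  loop-≢-null d v (w ∷ ws) b v∈ with w ≟ v
  ... | yes _ = λ ()
  loop-≢-null zero    v (w ∷ ws) b v∈ | no _ = λ ()
  loop-≢-null (suc d) v (w ∷ ws) b (here refl) | no w≢v = ⊥-elim (w≢v refl)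
  loop-≢-null (suc d) v (w ∷ ws) b (there v∈) | no _ with rec G π R d (b ∸ 1) w
  ... | timeout , _  = λ ()
  ... | null    , b′ = loop-≢-null (suc d) v ws b′ v∈
  ... | node p  , b′ with p ≟ w
  ...   | yes _ = λ ()
  ...   | no _  = loop-≢-null (suc d) v ws b′ v∈

  candidate : Fin n → Fin n → Bool
  candidate v w = (does (w ≟ v) ∨ adj G v w) ∧ R w ∧ (rank π w ≤ᵇ rank π v)

  Q⊆R : ∀ v → All (T ∘ R) (Q G π R v)
  Q⊆R v = All.map R-part (all-filter (T? ∘ candidate v) (byRank π))
    where
    R-part : ∀ {w} → T (candidate v w) → T (R w)
    R-part {w} = proj₁ ∘ Equivalence.to (T-∧ {R w})
               ∘ proj₂ ∘ Equivalence.to (T-∧ {does (w ≟ v) ∨ adj G v w})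

  ∈-Q-self : ∀ {v} → T (R v) → v ∈ Q G π R v
  ∈-Q-self {v} v∈R = ∈-filter⁺ (T? ∘ candidate v) {xs = byRank π} (∈-byRank π v) v-candidate
    where
    v-candidate : T (candidate v v)
    v-candidate with v ≟ v
    ... | yes _  = Equivalence.from T-∧ (v∈R , ≤⇒≤ᵇ (≤-refl {rank π v}))
    ... | no v≢v = ⊥-elim (v≢v refl)

  rec-≢-null : ∀ {v} → T (R v) → ∀ d b → proj₁ (rec G π R d b v) ≢ null
  rec-≢-null v∈R d zero    = λ ()
  rec-≢-null v∈R d (suc b) = loop-≢-null d _ (Q G π R _) (suc b) (∈-Q-self v∈R)

  mutual
    rec-mono : ∀ {d d′} → d ≤ d′ → ∀ b c v {res b₁} → rec G π R d b v ≡ (res , b₁) → res ≢ timeout →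
               rec G π R d′ (b + c) v ≡ (res , b₁ + c)
    rec-mono d≤d′ zero    c v refl ≢timeout = ⊥-elim (≢timeout refl)
    rec-mono d≤d′ (suc b) c v run  ≢timeout = loop-mono d≤d′ v (Q G π R v) (suc b) c run ≢timeout

    loop-mono : ∀ {d d′} → d ≤ d′ → ∀ v xs b c {res b₁} → loop G π R d v xs b ≡ (res , b₁) → res ≢ timeout →
                loop G π R d′ v xs (b + c) ≡ (res , b₁ + c)
    loop-mono z≤n v []       b c refl _ = refl
    loop-mono z≤n v (w ∷ ws) b c run  ≢timeout with w ≟ v
    loop-mono z≤n v (w ∷ ws) b c refl _        | yes _ = refl
    loop-mono z≤n v (w ∷ ws) b c refl ≢timeout | no _  = ⊥-elim (≢timeout refl)
    loop-mono {suc d} {suc d′} (s≤s d≤d′) v xs b c = go xs b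
      where
      go : ∀ xs b {res b₁} → loop G π R (suc d) v xs b ≡ (res , b₁) → res ≢ timeout →
           loop G π R (suc d′) v xs (b + c) ≡ (res , b₁ + c)
      go []       b       refl _ = refl
      go (w ∷ ws) b       run ≢timeout with w ≟ v
      go (w ∷ ws) b       refl _        | yes _ = refl
      go (w ∷ ws) zero    refl ≢timeout | no _  = ⊥-elim (≢timeout refl)
      go (w ∷ ws) (suc b) run  ≢timeout | no _ with rec G π R d b w in child
      go (w ∷ ws) (suc b) refl ≢timeout | no _ | timeout , _ = ⊥-elim (≢timeout refl)
      ... | null   , b′ rewrite rec-mono d≤d′ b c w child (λ ()) = go ws b′ run ≢timeout
      ... | node p , b′ rewrite rec-mono d≤d′ b c w child (λ ()) with p ≟ w
      go (w ∷ ws) (suc b) refl _ | no _ | node p , b′ | yes _ = refl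
      ...   | no _ = go ws b′ run ≢timeout

  rec-null-mono : ∀ {d d′ b b′ v} → d ≤ d′ → b ≤ b′ →
                  proj₁ (rec G π R d b v) ≡ null → proj₁ (rec G π R d′ b′ v) ≡ null
  rec-null-mono {d} {d′} {b} {b′} {v} d≤d′ b≤b′ isNull with rec G π R d b v in run
  rec-null-mono d≤d′ b≤b′ () | timeout , _
  rec-null-mono d≤d′ b≤b′ () | node _ , _
  rec-null-mono {d} {d′} {b} {b′} {v} d≤d′ b≤b′ refl | null , _ =
    subst (λ b″ → proj₁ (rec G π R d′ b″ v) ≡ null) (m+[n∸m]≡n b≤b′)
          (cong proj₁ (rec-mono d≤d′ b (b′ ∸ b) v run (λ ())))

  findPivot≡nothing⇔ : ∀ k u → findPivot G π k R u ≡ nothing ⇔ proj₁ (rec G π R n k u) ≡ null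
  findPivot≡nothing⇔ k u with rec G π R n k u
  ... | timeout , _ = mk⇔ (λ ()) (λ ())
  ... | null    , _ = mk⇔ (λ _ → refl) (λ _ → refl)
  ... | node _  , _ = mk⇔ (λ ()) (λ ())

module Simulation {n : ℕ} (G : SimpleGraph n) (π : Perm n) (r : ℕ) where

  R : Fin n → Bool
  R = prefixR π r

  module RunR = Run G π R
  module RunV = Run G π allV

  Q-split : ∀ v → ∃[ ys ] Q G π allV v ≡ Q G π R v ++ ys × All (λ y → ¬ T (R y)) ys
  Q-split v with filterᵇ-prefix-split R (RunV.candidate v) (prefixR-prefix π r)
  ... | ys , split , ys∉R =
    ys , trans split (cong (_++ ys) (filterᵇ-cong R∧candidate (byRank π))) , ys∉R
    where
    R∧candidate : ∀ w → R w ∧ RunV.candidate v w ≡ RunR.candidate v w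
    R∧candidate w with R w
    ... | true  = refl
    ... | false = sym (∧-zeroʳ _)

  NodeInR : Res n → Set
  NodeInR (node p) = T (R p)
  NodeInR _        = ⊤

  -- What the V-run may return once the R-run has returned null.  In the outside case w was
  -- returned by a nested call Rec(w) of the V-run, made with no more depth and budget.
  data Escapes (v : Fin n) (d b : ℕ) : Res n → Set where
    timeout : Escapes v d b timeout
    null    : Escapes v d b null
    self    : Escapes v d b (node v)
    outside : ∀ {w d′ b′} → ¬ T (R w) → d′ ≤ d → b′ ≤ b → proj₁ (rec G π R d′ b′ w) ≡ null →
              Escapes v d b (node w)

  data Agree (v : Fin n) (d b : ℕ) : Res n × ℕ → Res n × ℕ → Set where
    same      : ∀ {x} → NodeInR (proj₁ x) → Agree v d b x x
    exhausted : ∀ {b₁ y} → Escapes v d b (proj₁ y) → Agree v d b (null , b₁) y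

  Escapes-weaken : ∀ {v d b b′ res} → b ≤ b′ → Escapes v d b res → Escapes v d b′ res
  Escapes-weaken b≤b′ timeout                       = timeout
  Escapes-weaken b≤b′ null                          = null
  Escapes-weaken b≤b′ self                          = self
  Escapes-weaken b≤b′ (outside w∉R d″≤d b″≤b isNull) = outside w∉R d″≤d (≤-trans b″≤b b≤b′) isNull

  Agree-weaken : ∀ {v d b b′ x y} → b ≤ b′ → Agree v d b x y → Agree v d b′ x y
  Agree-weaken b≤b′ (same x∈R)      = same x∈R
  Agree-weaken b≤b′ (exhausted esc) = exhausted (Escapes-weaken b≤b′ esc)

  agree-outside-null : ∀ {w d b x b₁} → ¬ T (R w) → Agree w d b x (node w , b₁) → proj₁ x ≡ null
  agree-outside-null w∉R (same w∈R)    = ⊥-elim (w∉R w∈R)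
  agree-outside-null w∉R (exhausted _) = refl

  AgreeAt : ℕ → Set
  AgreeAt d = ∀ b v → Agree v d b (rec G π R d b v) (rec G π allV d b v)

  AgreeBelow : ℕ → Set
  AgreeBelow zero    = ⊤
  AgreeBelow (suc d) = AgreeAt d

  loop-escapes : ∀ d → AgreeBelow d → ∀ v ys → All (λ y → ¬ T (R y)) ys → ∀ b →
                 Escapes v d b (proj₁ (loop G π allV d v ys b))
  loop-escapes d below v []       _ b = null
  loop-escapes d below v (y ∷ ys) _ b with y ≟ v
  ... | yes refl = self
  loop-escapes zero    below v (y ∷ ys) _            b | no _ = timeout
  loop-escapes (suc d) below v (y ∷ ys) (y∉R ∷ ys∉R) b | no _
    with rec G π allV d (b ∸ 1) y | below (b ∸ 1) y | RunV.rec-budget-≤ d (b ∸ 1) y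
  ... | timeout , _ | _   | _   = timeout
  ... | null , b′   | _   | b′≤ =
    Escapes-weaken (≤-trans b′≤ (m∸n≤m b 1)) (loop-escapes (suc d) below v ys ys∉R b′)
  ... | node p , b′ | agr | b′≤ with p ≟ y
  ...   | yes refl = outside y∉R (n≤1+n d) (m∸n≤m b 1) (agree-outside-null y∉R agr)
  ...   | no _     =
    Escapes-weaken (≤-trans b′≤ (m∸n≤m b 1)) (loop-escapes (suc d) below v ys ys∉R b′)

  loop-agree : ∀ d → AgreeBelow d → ∀ v xs ys → All (T ∘ R) xs → All (λ y → ¬ T (R y)) ys → ∀ b →
               Agree v d b (loop G π R d v xs b) (loop G π allV d v (xs ++ ys) b)
  loop-agree d below v []       ys _            ys∉R b = exhausted (loop-escapes d below v ys ys∉R b)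
  loop-agree d below v (x ∷ xs) ys (x∈R ∷ xs⊆R) ys∉R b with x ≟ v
  ... | yes refl = same x∈R
  loop-agree zero    below v (x ∷ xs) ys _            _    b | no _ = same tt
  loop-agree (suc d) below v (x ∷ xs) ys (x∈R ∷ xs⊆R) ys∉R b | no _
    with rec G π R d (b ∸ 1) x | rec G π allV d (b ∸ 1) x | below (b ∸ 1) x
       | RunR.rec-≢-null x∈R d (b ∸ 1) | RunR.rec-budget-≤ d (b ∸ 1) x
  ... | _           | _ | exhausted _ | ≢null | _   = ⊥-elim (≢null refl)
  ... | timeout , _ | _ | same _        | _     | _   = same tt
  ... | null , b′   | _ | same _        | _     | b′≤ =
    Agree-weaken (≤-trans b′≤ (m∸n≤m b 1)) (loop-agree (suc d) below v xs ys xs⊆R ys∉R b′)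
  ... | node p , b′ | _ | same p∈R      | _     | b′≤ with p ≟ x
  ...   | yes _ = same p∈R
  ...   | no _  =
    Agree-weaken (≤-trans b′≤ (m∸n≤m b 1)) (loop-agree (suc d) below v xs ys xs⊆R ys∉R b′)

  mutual
    rec-agree : ∀ d → AgreeAt d
    rec-agree d zero    v = same tt
    rec-agree d (suc b) v with Q-split v
    ... | ys , QV≡QR++ys , ys∉R =
      subst (λ xs → Agree v d (suc b) (loop G π R d v (Q G π R v) (suc b)) (loop G π allV d v xs (suc b)))
            (sym QV≡QR++ys) (loop-agree d (agree-below d) v (Q G π R v) ys (RunR.Q⊆R v) ys∉R (suc b))

    agree-below : ∀ d → AgreeBelow d
    agree-below zero    = tt
    agree-below (suc d) = rec-agree d

  agree-node-null⇔ : ∀ {k u p x b₁} → Agree u n k x (node p , b₁) →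
                     p ≡ u ⊎ (proj₁ x ≡ null ⇔ proj₁ (rec G π R n k p) ≡ null)
  agree-node-null⇔ {k} (same p∈R) = inj₂ (mk⇔ (λ ()) (⊥-elim ∘ RunR.rec-≢-null p∈R n k))
  agree-node-null⇔ (exhausted self) = inj₁ refl
  agree-node-null⇔ (exhausted (outside _ d′≤n b′≤k isNull)) =
    inj₂ (mk⇔ (λ _ → RunR.rec-null-mono d′≤n b′≤k isNull) (λ _ → refl))

  pivot-preserves-InA : ∀ k u → ∃[ p ] pivot G π k u ≡ just p × (InA G π k r u ⇔ InA G π k r p)
  pivot-preserves-InA k u with rec G π allV n k u | rec-agree n k u | RunV.rec-≢-null {u} tt n k
  ... | timeout , _ | _   | _     = u , refl , ⇔-refl
  ... | null , _    | _   | ≢null = ⊥-elim (≢null refl)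
  ... | node p , _  | agr | _     = p , refl , InA⇔ (agree-node-null⇔ agr)
    where
    InA⇔ : p ≡ u ⊎ (proj₁ (rec G π R n k u) ≡ null ⇔ proj₁ (rec G π R n k p) ≡ null) →
           InA G π k r u ⇔ InA G π k r p
    InA⇔ (inj₁ refl)  = ⇔-refl
    InA⇔ (inj₂ null⇔) = ¬-cong-⇔ (⇔-trans (RunR.findPivot≡nothing⇔ k u)
                                  (⇔-trans null⇔ (⇔-sym (RunR.findPivot≡nothing⇔ k p))))

lemma1 : (n : ℕ) (G : SimpleGraph n) (π : Perm n) (k : ℕ) → 1 ≤ k → (r : ℕ) → (u : Fin n)
         → Σ (Fin n) (λ p → (pivot G π k u ≡ just p)
              × ((InA G π k r u ⇔ InA G π k r p) × (InB G π k r u ⇔ InB G π k r p)))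
lemma1 n G π k _ r u with Simulation.pivot-preserves-InA G π r k u
... | p , pivot≡p , A⇔A = p , pivot≡p , A⇔A , ¬-cong-⇔ A⇔A
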